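{- Let $(p\colon\mathbb{E}\to\mathbb{B},O,\Omega)$ be a $\mathbf{CLat}_\sqcap$-fibration with truth values indexed by discrete $A$, $F\colon\mathbb{B}\to\mathbb{B}$, $\tau\colon F\circ O\Rightarrow O$, $(T,\lambda)$ an $N$-ary one-step composition and $\sigma\colon T\circ\langle O,\dots,O\rangle\Rightarrow O$. If for each $a\in A$ the distributive law $\lambda$ is liftable with respect to $T^{\Omega}_{\sigma}\circ(F^{\Omega(a)}_{\tau_a})^N$ and $F^{\Omega(a)}_{\tau_a}\circ T^{\Omega}_{\sigma}$, i.e. $T^{\Omega}_{\sigma}(F^{\Omega(a)}_{\tau_a}P_1,\dots,F^{\Omega(a)}_{\tau_a}P_N)\sqsubseteq\lambda^*F^{\Omega(a)}_{\tau_a}(T^{\Omega}_{\sigma}(P_1,\dots,P_N))$ for all $P_i$, then $\sigma$ lifts $\lambda$, i.e. $T^{\Omega}_{\sigma}(F^{\Omega}_{\tau}P_1,\dots,F^{\Omega}_{\tau}P_N)\sqsubseteq\lambda^*F^{\Omega}_{\tau}(T^{\Omega}_{\sigma}(P_1,\dots,P_N))$ for all $P_1,\dots,P_N\in\mathbb{E}$.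
   Context: A $\mathbf{CLat}_\sqcap$-fibration has complete-lattice fibers (order $\sqsubseteq$, meet $\bigwedge$) and meet-preserving reindexing; $O=p\circ\Omega$. An $N$-ary one-step composition is $T\colon\mathbb{B}^N\to\mathbb{B}$ with $\lambda\colon T\circ F^N\Rightarrow F\circ T$. $F^{\Omega}_{\tau}(P)=\bigwedge_{a\in A,\,k\in\mathbb{E}(P,\Omega(a))}(\tau_a\circ F(pk))^*\Omega(a)$; $F^{\Omega(a)}_{\tau_a}(P)=\bigwedge_{k\in\mathbb{E}(P,\Omega(a))}(\tau_a\circ F(pk))^*\Omega(a)$; $T^{\Omega}_{\sigma}(P_1,\dots,P_N)=\bigwedge_{a\in A,\,k_i\in\mathbb{E}(P_i,\Omega(a))}(\sigma_a\circ T(pk_1,\dots,pk_N))^*\Omega(a)$. -}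

module Defs where

open import Level using (Level; suc)
open import Data.Nat using (ℕ)
open import Data.Fin using (Fin)
open import Data.Product using (Σ; _,_)
open import Relation.Binary.PropositionalEquality using (_≡_)

record Category (ℓ : Level) : Set (suc ℓ) where
  infixr 9 _∘_
  field
    Obj  : Set ℓ
    Hom  : Obj → Obj → Set ℓ
    id   : ∀ {X} → Hom X X
    _∘_  : ∀ {X Y Z} → Hom Y Z → Hom X Y → Hom X Z
    identityˡ : ∀ {X Y} (f : Hom X Y) → id ∘ f ≡ f
    identityʳ : ∀ {X Y} (f : Hom X Y) → f ∘ id ≡ f
    assoc : ∀ {W X Y Z} (h : Hom Y Z) (g : Hom X Y) (f : Hom W X) →
            (h ∘ g) ∘ f ≡ h ∘ (g ∘ f)

record Endofunctor {ℓ : Level} (𝔹 : Category ℓ) : Set ℓ where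
  open Category 𝔹
  field
    F₀ : Obj → Obj
    F₁ : ∀ {X Y} → Hom X Y → Hom (F₀ X) (F₀ Y)
    F-id : ∀ {X} → F₁ (id {X}) ≡ id
    F-∘  : ∀ {X Y Z} (g : Hom Y Z) (f : Hom X Y) → F₁ (g ∘ f) ≡ F₁ g ∘ F₁ f

record NaryFunctor {ℓ : Level} (𝔹 : Category ℓ) (N : ℕ) : Set ℓ where
  open Category 𝔹
  field
    T₀ : (Fin N → Obj) → Obj
    T₁ : ∀ {X Y : Fin N → Obj} → (∀ i → Hom (X i) (Y i)) → Hom (T₀ X) (T₀ Y)
    T-cong : ∀ {X Y : Fin N → Obj} {f g : ∀ i → Hom (X i) (Y i)} →
             (∀ i → f i ≡ g i) → T₁ f ≡ T₁ g
    T-id : ∀ {X : Fin N → Obj} → T₁ (λ i → id {X i}) ≡ id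
    T-∘  : ∀ {X Y Z : Fin N → Obj} (g : ∀ i → Hom (Y i) (Z i)) (f : ∀ i → Hom (X i) (Y i)) →
           T₁ (λ i → g i ∘ f i) ≡ T₁ g ∘ T₁ f

record OneStepComposition {ℓ : Level} (𝔹 : Category ℓ) (F : Endofunctor 𝔹) (N : ℕ) : Set ℓ where
  open Category 𝔹
  open Endofunctor F
  field
    T : NaryFunctor 𝔹 N
  open NaryFunctor T
  field
    dist : ∀ (X : Fin N → Obj) → Hom (T₀ (λ i → F₀ (X i))) (F₀ (T₀ X))
    dist-natural : ∀ {X Y : Fin N → Obj} (f : ∀ i → Hom (X i) (Y i)) →
      dist Y ∘ T₁ (λ i → F₁ (f i)) ≡ F₁ (T₁ f) ∘ dist X

-- A CLat_⊓-fibration over 𝔹, presented (equivalently, as it is posetal)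
-- as an indexed complete lattice: fibres 𝔼_X are complete lattices
-- (order ⊑, arbitrary meets ⋀) and reindexing f* preserves all meets.
record CLatFibration {ℓ : Level} (𝔹 : Category ℓ) : Set (suc ℓ) where
  open Category 𝔹
  field
    Fib : Obj → Set ℓ
    _⊑_ : ∀ {X} → Fib X → Fib X → Set ℓ
    ⊑-refl : ∀ {X} {P : Fib X} → P ⊑ P
    ⊑-trans : ∀ {X} {P Q R : Fib X} → P ⊑ Q → Q ⊑ R → P ⊑ R
    ⊑-antisym : ∀ {X} {P Q : Fib X} → P ⊑ Q → Q ⊑ P → P ≡ Q
    ⋀ : ∀ {X} {I : Set ℓ} → (I → Fib X) → Fib X
    ⋀-lower : ∀ {X} {I : Set ℓ} (f : I → Fib X) (i : I) → ⋀ f ⊑ f i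
    ⋀-greatest : ∀ {X} {I : Set ℓ} (f : I → Fib X) {Q : Fib X} →
                 (∀ i → Q ⊑ f i) → Q ⊑ ⋀ f
    reindex : ∀ {X Y} → Hom X Y → Fib Y → Fib X
    reindex-⋀ : ∀ {X Y} (h : Hom X Y) {I : Set ℓ} (f : I → Fib Y) →
                reindex h (⋀ f) ≡ ⋀ (λ i → reindex h (f i))
    reindex-id : ∀ {X} (P : Fib X) → reindex id P ≡ P
    reindex-∘ : ∀ {X Y Z} (g : Hom Y Z) (f : Hom X Y) (P : Fib Z) →
                reindex (g ∘ f) P ≡ reindex f (reindex g P)

-- The liftings F^Ω_τ, F^{Ω(a)}_{τ_a}, T^Ω_σ.  A morphism k ∈ 𝔼(P, Ω(a))
-- with P over X is a base morphism k = pk : X → O(a) with P ⊑ k*Ω(a).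
module Liftings {ℓ : Level} {𝔹 : Category ℓ} (L : CLatFibration 𝔹)
  (A : Set ℓ) (O : A → Category.Obj 𝔹) (Ω : (a : A) → CLatFibration.Fib L (O a))
  (F : Endofunctor 𝔹) where
  open Category 𝔹
  open CLatFibration L
  open Endofunctor F

  FΩ : (τ : ∀ a → Hom (F₀ (O a)) (O a)) → ∀ {X} → Fib X → Fib (F₀ X)
  FΩ τ {X} P = ⋀ {I = Σ A (λ a → Σ (Hom X (O a)) (λ k → P ⊑ reindex k (Ω a)))}
                 (λ { (a , k , _) → reindex (τ a ∘ F₁ k) (Ω a) })

  FΩa : (a : A) (τa : Hom (F₀ (O a)) (O a)) → ∀ {X} → Fib X → Fib (F₀ X)
  FΩa a τa {X} P = ⋀ {I = Σ (Hom X (O a)) (λ k → P ⊑ reindex k (Ω a))}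
                     (λ { (k , _) → reindex (τa ∘ F₁ k) (Ω a) })

  TΩ : ∀ {N} (T : NaryFunctor 𝔹 N) →
       (σ : ∀ a → Hom (NaryFunctor.T₀ T (λ _ → O a)) (O a)) →
       ∀ {X : Fin N → Obj} → (∀ i → Fib (X i)) → Fib (NaryFunctor.T₀ T X)
  TΩ {N} T σ {X} P =
    ⋀ {I = Σ A (λ a → Σ (∀ i → Hom (X i) (O a)) (λ k → ∀ i → P i ⊑ reindex (k i) (Ω a)))}
      (λ { (a , k , _) → reindex (σ a ∘ NaryFunctor.T₁ T k) (Ω a) })

-- F^Ω_τ is the meet over a ∈ A of the single-truth-value liftings F^{Ω(a)}_{τ_a},
-- and T^Ω_σ is monotone, so T^Ω_σ(F^Ω_τ P) lies below T^Ω_σ(F^{Ω(a)}_{τ_a} P) for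
-- every a, hence below λ*F^{Ω(a)}_{τ_a}(T^Ω_σ P) by hypothesis. Since reindexing
-- along λ preserves meets, lying below all of these is lying below λ*F^Ω_τ(T^Ω_σ P).
module Submission where

open import Defs
open import Level using (Level)
open import Data.Nat using (ℕ)
open import Data.Fin using (Fin)
open import Data.Product using (_,_)
open import Relation.Binary.PropositionalEquality using (subst; sym)

module CLatFibrationProperties {ℓ : Level} {𝔹 : Category ℓ} (L : CLatFibration 𝔹) where
  open Category 𝔹
  open CLatFibration L

  reindex-⋀-lower : ∀ {X Y} (h : Hom X Y) {I : Set ℓ} (f : I → Fib Y) (i : I) →
                    reindex h (⋀ f) ⊑ reindex h (f i)
  reindex-⋀-lower h f i =
    subst (_⊑ reindex h (f i)) (sym (reindex-⋀ h f)) (⋀-lower _ i)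

  ⊑-reindex-⋀ : ∀ {X Y} (h : Hom X Y) {I : Set ℓ} (f : I → Fib Y) {Q : Fib X} →
                (∀ i → Q ⊑ reindex h (f i)) → Q ⊑ reindex h (⋀ f)
  ⊑-reindex-⋀ h f Q⊑ = subst (_ ⊑_) (sym (reindex-⋀ h f)) (⋀-greatest _ Q⊑)

module LiftingProperties {ℓ : Level} {𝔹 : Category ℓ} (L : CLatFibration 𝔹)
  (A : Set ℓ) (O : A → Category.Obj 𝔹) (Ω : (a : A) → CLatFibration.Fib L (O a))
  (F : Endofunctor 𝔹) where
  open Category 𝔹
  open CLatFibration L
  open CLatFibrationProperties L
  open Liftings L A O Ω F
  open Endofunctor F using (F₀)

  FΩ⊑FΩa : (τ : ∀ a → Hom (F₀ (O a)) (O a)) (a : A) {X : Obj} (P : Fib X) →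
           FΩ τ P ⊑ FΩa a (τ a) P
  FΩ⊑FΩa τ a P = ⋀-greatest _ λ { (k , P⊑k*Ωa) → ⋀-lower _ (a , k , P⊑k*Ωa) }

  ⊑-reindex-FΩ : (τ : ∀ a → Hom (F₀ (O a)) (O a)) {X Y : Obj} (h : Hom X (F₀ Y))
                 {P : Fib X} {Q : Fib Y} →
                 (∀ a → P ⊑ reindex h (FΩa a (τ a) Q)) → P ⊑ reindex h (FΩ τ Q)
  ⊑-reindex-FΩ τ h P⊑ = ⊑-reindex-⋀ h _ λ { (a , k , Q⊑k*Ωa) →
    ⊑-trans (P⊑ a) (reindex-⋀-lower h _ (k , Q⊑k*Ωa)) }

  TΩ-mono : ∀ {N} (T : NaryFunctor 𝔹 N)
            (σ : ∀ a → Hom (NaryFunctor.T₀ T (λ _ → O a)) (O a))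
            {X : Fin N → Obj} {P Q : ∀ i → Fib (X i)} →
            (∀ i → P i ⊑ Q i) → TΩ T σ P ⊑ TΩ T σ Q
  TΩ-mono T σ P⊑Q = ⋀-greatest _ λ { (a , k , Q⊑k*Ωa) →
    ⋀-lower _ (a , k , λ i → ⊑-trans (P⊑Q i) (Q⊑k*Ωa i)) }

proposition6 : {ℓ : Level} (𝔹 : Category ℓ) (L : CLatFibration 𝔹)
    (A : Set ℓ) (O : A → Category.Obj 𝔹) (Ω : (a : A) → CLatFibration.Fib L (O a))
    (F : Endofunctor 𝔹)
    (τ : (a : A) → Category.Hom 𝔹 (Endofunctor.F₀ F (O a)) (O a))
    (N : ℕ) (TL : OneStepComposition 𝔹 F N)
    (σ : (a : A) → Category.Hom 𝔹 (NaryFunctor.T₀ (OneStepComposition.T TL) (λ _ → O a)) (O a)) →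
    ((a : A) (X : Fin N → Category.Obj 𝔹) (P : (i : Fin N) → CLatFibration.Fib L (X i)) →
      CLatFibration._⊑_ L
        (Liftings.TΩ L A O Ω F (OneStepComposition.T TL) σ
           (λ i → Liftings.FΩa L A O Ω F a (τ a) (P i)))
        (CLatFibration.reindex L (OneStepComposition.dist TL X)
           (Liftings.FΩa L A O Ω F a (τ a)
              (Liftings.TΩ L A O Ω F (OneStepComposition.T TL) σ P)))) →
    (X : Fin N → Category.Obj 𝔹) (P : (i : Fin N) → CLatFibration.Fib L (X i)) →
      CLatFibration._⊑_ L
        (Liftings.TΩ L A O Ω F (OneStepComposition.T TL) σ
           (λ i → Liftings.FΩ L A O Ω F τ (P i)))
        (CLatFibration.reindex L (OneStepComposition.dist TL X)
           (Liftings.FΩ L A O Ω F τ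
              (Liftings.TΩ L A O Ω F (OneStepComposition.T TL) σ P)))
proposition6 𝔹 L A O Ω F τ N TL σ liftable-at X P =
  ⊑-reindex-FΩ τ (dist X) λ a →
    ⊑-trans (TΩ-mono T σ (λ i → FΩ⊑FΩa τ a (P i))) (liftable-at a X P)
  where
  open CLatFibration L using (⊑-trans)
  open LiftingProperties L A O Ω F
  open OneStepComposition TL using (T; dist)
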